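{- Let $V=\{v_\nu\geq\cdots\geq v_1\}$, $\nu\geq 2$, be a multiset of positive integers. Then: (i) for any $\nu\geq j>i\geq 1$, $p(V\setminus\{v_j,v_i\}\cup\{v_j+1\}\cup\{v_i-1\})\succ p(V)$; (ii) if $\nu\geq 3$ and $v_3>v_2$, then for any $\nu\geq j\geq 3$ and $i\in\{2,1\}$, $p(V\setminus\{v_j,v_i\}\cup\{v_j+1\}\cup\{v_i-1\})\succ p(V)\boxplus 1$; (iii) if $v_1\geq 2$, then $p(V\setminus\{v_1\}\cup\{v_1-1,1\})=p(V)\boxminus 1$; (iv) if $v_1=1$, then $p(V\setminus\{v_1\}\cup\{v_1-1,1\})=p(V)$.
   Context: All operations are multiset operations. For a multiset $S$ of nonnegative integers with sum $k$, $p(S)$ is the number partition of $k$ obtained by sorting the positive elements of $S$ in non-increasing order (elements equal to $0$ are discarded). For two number partitions $p,q$ of the same integer $k$, $p\succ q$ means $p$ is lexicographically strictly larger than $q$ (comparing the sequences entry by entry from the largest part). For a partition $p$ of $k$ and an integer $i\geq 0$, $p\boxplus i$ and $p\boxminus i$ denote the partitions of $k$ coming $i$ positions after, respectively before, $p$ in the lexicographic order of all number partitions of $k$. -}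

module Defs where

open import Data.Nat using (ℕ; zero; suc; _≥_; _>_; _<_; _≤?_; _≥?_)
open import Data.List using (List; []; _∷_; foldr; filter)
open import Data.Nat.ListAction using (sum)
open import Data.List.Relation.Unary.All using (All)
open import Data.List.Relation.Unary.Linked using (Linked)
open import Data.Product using (_×_)
open import Relation.Nullary using (¬_; yes; no)
open import Relation.Binary.PropositionalEquality using (_≡_)

insertDesc : ℕ → List ℕ → List ℕ
insertDesc x [] = x ∷ []
insertDesc x (y ∷ ys) with x ≥? y
... | yes _ = x ∷ y ∷ ys
... | no  _ = y ∷ insertDesc x ys

sortDesc : List ℕ → List ℕ
sortDesc = foldr insertDesc []

-- p(S): drop the zeros and sort the remaining elements non-increasingly.
-- A multiset S is represented by any list enumerating it (p is invariant under reordering).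
p : List ℕ → List ℕ
p S = sortDesc (filter (1 ≤?_) S)

IsPartition : ℕ → List ℕ → Set
IsPartition k q = Linked _≥_ q × All (_> 0) q × sum q ≡ k

-- strict lexicographic order, comparing from the first (largest) part;
-- a proper prefix is smaller (never relevant between partitions of the same k)
data _≻_ : List ℕ → List ℕ → Set where
  nonempty : ∀ {x xs} → (x ∷ xs) ≻ []
  here     : ∀ {x y xs ys} → x > y → (x ∷ xs) ≻ (y ∷ ys)
  there    : ∀ {x xs ys} → xs ≻ ys → (x ∷ xs) ≻ (x ∷ ys)

-- IsNext k a b : a, b are partitions of k and b comes immediately after a
-- in the lexicographic order of all partitions of k, i.e. b = a ⊞ 1 (equivalently a = b ⊟ 1)
IsNext : ℕ → List ℕ → List ℕ → Set
IsNext k a b = IsPartition k a × IsPartition k b × b ≻ a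
             × (∀ r → IsPartition k r → ¬ (b ≻ r × r ≻ a))

{-# OPTIONS --safe #-}
-- Split a list at a threshold x: sortDesc lists the parts above x, then those at most x.
-- Moving a unit from a part a ≤ x to a part x leaves the parts above x unchanged except
-- for a new part x + 1; inserting it into the sorted parts above x beats every list that
-- continues them with an entry at most x.  This gives (i), and (ii) once the successor of
-- p(V) is known.  The lexicographic successor of P ++ [b , c + 1], all parts of P above b,
-- is P ++ (b + 1) ∷ 1ᶜ: a partition in between must share the prefix P, and then its
-- remainder would lie strictly between [b , c + 1] and (b + 1) ∷ 1ᶜ, which is impossible.
-- (iii) is the case c = 0 of this.
module Submission where

open import Defs
open import Data.Nat using (ℕ; zero; suc; _+_; _≤_; _<_; _>_; _≥_; _∸_; _≤?_; _<?_; _≥?_; z≤n; s≤s)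
open import Data.Nat.Properties
open import Data.Fin using (Fin; toℕ) renaming (zero to fz; suc to fs)
open import Data.Vec.Functional using (toList; updateAt)
open import Data.List using (List; []; _∷_; _++_; filter; replicate)
open import Data.List.Properties using (filter-accept; filter-reject; filter-++; filter-all; filter-none; ++-assoc)
open import Data.Nat.ListAction using (sum)
open import Data.Nat.ListAction.Properties using (sum-++)
open import Data.List.Relation.Unary.All as All using (All; []; _∷_)
open import Data.List.Relation.Unary.All.Properties using (all-filter; tabulate⁺; replicate⁺; ++⁺; ++⁻ˡ; ++⁻ʳ)
open import Data.List.Relation.Unary.Linked as Linked using (Linked; []; [-]; _∷_)
open import Data.Product using (_×_; _,_; Σ; ∃; ∃₂)
open import Data.Sum using (inj₁; inj₂)
open import Relation.Nullary using (¬_; yes; no)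
open import Relation.Unary using (Pred; Decidable)
open import Relation.Nullary.Negation using (contradiction)
open import Relation.Binary.Definitions using (tri<; tri≈; tri>)
open import Relation.Binary.PropositionalEquality

private
  variable
    a b c k x y z : ℕ
    A L M Z Z′ : List ℕ

-- Sorting

insertDesc-≥ : ∀ ys → y ≤ x → insertDesc x (y ∷ ys) ≡ x ∷ y ∷ ys
insertDesc-≥ {y} {x} ys y≤x with x ≥? y
... | yes _   = refl
... | no y≰x = contradiction y≤x y≰x

insertDesc-< : ∀ ys → x < y → insertDesc x (y ∷ ys) ≡ y ∷ insertDesc x ys
insertDesc-< {x} {y} ys x<y with x ≥? y
... | yes y≤x = contradiction y≤x (<⇒≱ x<y)
... | no _    = refl

insertDesc-head : Linked _≥_ (x ∷ L) → insertDesc x L ≡ x ∷ L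
insertDesc-head [-]       = refl
insertDesc-head (x≥y ∷ _) = insertDesc-≥ _ x≥y

insertDesc-∷ : ∀ x L → ∃₂ λ z Z → insertDesc x L ≡ z ∷ Z
insertDesc-∷ x []      = x , [] , refl
insertDesc-∷ x (y ∷ L) with x ≥? y
... | yes _ = x , y ∷ L , refl
... | no _  = y , insertDesc x L , refl

insertDesc-All : ∀ {ℓ} {P : Pred ℕ ℓ} {x L} → P x → All P L → All P (insertDesc x L)
insertDesc-All {L = []}        px []        = px ∷ []
insertDesc-All {x = x} {y ∷ L} px (py ∷ pL) with x ≥? y
... | yes _ = px ∷ py ∷ pL
... | no _  = py ∷ insertDesc-All px pL

sortDesc-All : ∀ {ℓ} {P : Pred ℕ ℓ} {L} → All P L → All P (sortDesc L)
sortDesc-All []        = []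
sortDesc-All (px ∷ pL) = insertDesc-All px (sortDesc-All pL)

insertDesc-Linked : ∀ x → Linked _≥_ L → Linked _≥_ (insertDesc x L)
insertDesc-Linked x [] = [-]
insertDesc-Linked {y ∷ []} x [-] with x ≥? y
... | yes x≥y = x≥y ∷ [-]
... | no x≱y  = ≰⇒≥ x≱y ∷ [-]
insertDesc-Linked {y ∷ y′ ∷ L} x (y≥y′ ∷ L↓) with x ≥? y
... | yes x≥y = x≥y ∷ y≥y′ ∷ L↓
... | no x≱y with x ≥? y′ | insertDesc-Linked x L↓
...   | yes _ | ins↓ = ≰⇒≥ x≱y ∷ ins↓
...   | no _  | ins↓ = y≥y′ ∷ ins↓

sortDesc-Linked : ∀ L → Linked _≥_ (sortDesc L)
sortDesc-Linked []      = []
sortDesc-Linked (x ∷ L) = insertDesc-Linked x (sortDesc-Linked L)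

insertDesc-sum : ∀ x L → sum (insertDesc x L) ≡ x + sum L
insertDesc-sum x []      = refl
insertDesc-sum x (y ∷ L) with x ≥? y
... | yes _ = refl
... | no _  = begin
  y + sum (insertDesc x L) ≡⟨ cong (y +_) (insertDesc-sum x L) ⟩
  y + (x + sum L)          ≡⟨ +-comm y _ ⟩
  x + sum L + y            ≡⟨ +-assoc x _ _ ⟩
  x + (sum L + y)          ≡⟨ cong (x +_) (+-comm (sum L) y) ⟩
  x + (y + sum L)          ∎
  where open ≡-Reasoning

sortDesc-sum : ∀ L → sum (sortDesc L) ≡ sum L
sortDesc-sum []      = refl
sortDesc-sum (x ∷ L) = trans (insertDesc-sum x (sortDesc L)) (cong (x +_) (sortDesc-sum L))

sum-filter-positive : ∀ L → sum (filter (1 ≤?_) L) ≡ sum L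
sum-filter-positive []          = refl
sum-filter-positive (zero ∷ L)  = sum-filter-positive L
sum-filter-positive (suc x ∷ L) = cong (suc x +_) (sum-filter-positive L)

p-IsPartition : ∀ L → IsPartition (sum L) (p L)
p-IsPartition L =
  sortDesc-Linked (filter (1 ≤?_) L) , sortDesc-All (all-filter (1 ≤?_) L) ,
  trans (sortDesc-sum (filter (1 ≤?_) L)) (sum-filter-positive L)

insertDesc-comm-< : ∀ L → y < x → insertDesc x (insertDesc y L) ≡ insertDesc y (insertDesc x L)
insertDesc-comm-< {y} {x} [] y<x = trans (insertDesc-≥ [] (<⇒≤ y<x)) (sym (insertDesc-< [] y<x))
insertDesc-comm-< {y} {x} (w ∷ L) y<x with ≤-<-connex w y | ≤-<-connex w x
... | inj₁ w≤y | _ = begin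
  insertDesc x (insertDesc y (w ∷ L)) ≡⟨ cong (insertDesc x) (insertDesc-≥ L w≤y) ⟩
  insertDesc x (y ∷ w ∷ L)           ≡⟨ insertDesc-≥ _ (<⇒≤ y<x) ⟩
  x ∷ y ∷ w ∷ L                      ≡⟨ cong (x ∷_) (insertDesc-≥ L w≤y) ⟨
  x ∷ insertDesc y (w ∷ L)           ≡⟨ insertDesc-< _ y<x ⟨
  insertDesc y (x ∷ w ∷ L)           ≡⟨ cong (insertDesc y) (insertDesc-≥ L (≤-trans w≤y (<⇒≤ y<x))) ⟨
  insertDesc y (insertDesc x (w ∷ L)) ∎
  where open ≡-Reasoning
... | inj₂ y<w | inj₁ w≤x = begin
  insertDesc x (insertDesc y (w ∷ L)) ≡⟨ cong (insertDesc x) (insertDesc-< L y<w) ⟩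
  insertDesc x (w ∷ insertDesc y L)  ≡⟨ insertDesc-≥ _ w≤x ⟩
  x ∷ w ∷ insertDesc y L             ≡⟨ cong (x ∷_) (insertDesc-< L y<w) ⟨
  x ∷ insertDesc y (w ∷ L)           ≡⟨ insertDesc-< _ y<x ⟨
  insertDesc y (x ∷ w ∷ L)           ≡⟨ cong (insertDesc y) (insertDesc-≥ L w≤x) ⟨
  insertDesc y (insertDesc x (w ∷ L)) ∎
  where open ≡-Reasoning
... | inj₂ y<w | inj₂ x<w = begin
  insertDesc x (insertDesc y (w ∷ L)) ≡⟨ cong (insertDesc x) (insertDesc-< L y<w) ⟩
  insertDesc x (w ∷ insertDesc y L)  ≡⟨ insertDesc-< _ x<w ⟩
  w ∷ insertDesc x (insertDesc y L)  ≡⟨ cong (w ∷_) (insertDesc-comm-< L y<x) ⟩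
  w ∷ insertDesc y (insertDesc x L)  ≡⟨ insertDesc-< _ y<w ⟨
  insertDesc y (w ∷ insertDesc x L)  ≡⟨ cong (insertDesc y) (insertDesc-< L x<w) ⟨
  insertDesc y (insertDesc x (w ∷ L)) ∎
  where open ≡-Reasoning

insertDesc-comm : ∀ x y L → insertDesc x (insertDesc y L) ≡ insertDesc y (insertDesc x L)
insertDesc-comm x y L with <-cmp y x
... | tri< y<x _ _ = insertDesc-comm-< L y<x
... | tri≈ _ refl _ = refl
... | tri> _ _ x<y = sym (insertDesc-comm-< L x<y)

sortDesc-++-∷ : ∀ A y C → sortDesc (A ++ y ∷ C) ≡ insertDesc y (sortDesc (A ++ C))
sortDesc-++-∷ []      y C = refl
sortDesc-++-∷ (x ∷ A) y C = trans (cong (insertDesc x) (sortDesc-++-∷ A y C))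
                                 (insertDesc-comm x y (sortDesc (A ++ C)))

insertDesc-++-above : All (x <_) A → insertDesc x (A ++ L) ≡ A ++ insertDesc x L
insertDesc-++-above {A = []}    []          = refl
insertDesc-++-above {A = w ∷ A} (x<w ∷ x<A) =
  trans (insertDesc-< _ x<w) (cong (w ∷_) (insertDesc-++-above x<A))

insertDesc-++-below : ∀ A → All (_≤ x) L → insertDesc x (A ++ L) ≡ insertDesc x A ++ L
insertDesc-++-below []      []          = refl
insertDesc-++-below []      (w≤x ∷ _) = insertDesc-≥ _ w≤x
insertDesc-++-below {x} (w ∷ A) L≤x with x ≥? w
... | yes _ = refl
... | no _  = cong (w ∷_) (insertDesc-++-below A L≤x)

sortDesc-threshold : ∀ t L → sortDesc L ≡ sortDesc (filter (t <?_) L) ++ sortDesc (filter (_≤? t) L)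
sortDesc-threshold t []      = refl
sortDesc-threshold t (y ∷ L) with y ≤? t
... | yes y≤t
  rewrite filter-reject (t <?_) {y} {L} (≤⇒≯ y≤t) | filter-accept (_≤? t) {y} {L} y≤t
  = trans (cong (insertDesc y) (sortDesc-threshold t L))
          (insertDesc-++-above (sortDesc-All (All.map (≤-<-trans y≤t) (all-filter (t <?_) L))))
... | no y≰t
  rewrite filter-accept (t <?_) {y} {L} (≰⇒> y≰t) | filter-reject (_≤? t) {y} {L} y≰t
  = trans (cong (insertDesc y) (sortDesc-threshold t L))
          (insertDesc-++-below (sortDesc (filter (t <?_) L))
             (sortDesc-All (All.map (λ w≤t → ≤-trans w≤t (<⇒≤ (≰⇒> y≰t))) (all-filter (_≤? t) L))))

insertDesc-min : Linked _≥_ L → All (x ≤_) L → insertDesc x L ≡ L ++ x ∷ []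
insertDesc-min {[]}        _  _           = refl
insertDesc-min {w ∷ L} {x} L↓ (x≤w ∷ x≤L) with x ≥? w
... | no _ = cong (w ∷_) (insertDesc-min (Linked.tail L↓) x≤L)
... | yes w≤x rewrite ≤-antisym w≤x x≤w =
  cong (x ∷_) (trans (sym (insertDesc-head L↓)) (insertDesc-min (Linked.tail L↓) x≤L))

sortDesc-∷-min : All (x ≤_) L → sortDesc (x ∷ L) ≡ sortDesc L ++ x ∷ []
sortDesc-∷-min {L = L} x≤L = insertDesc-min (sortDesc-Linked L) (sortDesc-All x≤L)

sortDesc-∷-∷-min : a ≤ b → All (b ≤_) L → sortDesc (a ∷ b ∷ L) ≡ sortDesc L ++ b ∷ a ∷ []
sortDesc-∷-∷-min {a} {b} {L} a≤b b≤L = begin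
  sortDesc (a ∷ b ∷ L)          ≡⟨ sortDesc-∷-min (a≤b ∷ All.map (≤-trans a≤b) b≤L) ⟩
  sortDesc (b ∷ L) ++ a ∷ []    ≡⟨ cong (_++ a ∷ []) (sortDesc-∷-min b≤L) ⟩
  (sortDesc L ++ b ∷ []) ++ a ∷ [] ≡⟨ ++-assoc (sortDesc L) _ _ ⟩
  sortDesc L ++ b ∷ a ∷ []      ∎
  where open ≡-Reasoning

-- Lexicographic order

≻-++ˡ : ∀ P {X Y} → X ≻ Y → (P ++ X) ≻ (P ++ Y)
≻-++ˡ []      X≻Y = X≻Y
≻-++ˡ (q ∷ P) X≻Y = there (≻-++ˡ P X≻Y)

between-++ˡ : ∀ P {X Y r} → (P ++ X) ≻ r → r ≻ (P ++ Y) →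
              ∃ λ r′ → r ≡ P ++ r′ × X ≻ r′ × r′ ≻ Y
between-++ˡ []      X≻r r≻Y                 = _ , refl , X≻r , r≻Y
between-++ˡ (q ∷ P) (here q>w)  (here w>q)  = contradiction q>w (<-asym w>q)
between-++ˡ (q ∷ P) (here q>q)  (there _)   = contradiction q>q (<-irrefl refl)
between-++ˡ (q ∷ P) (there _)   (here q>q)  = contradiction q>q (<-irrefl refl)
between-++ˡ (q ∷ P) (there X≻r) (there r≻Y) with between-++ˡ P X≻r r≻Y
... | r′ , refl , X≻r′ , r′≻Y = r′ , refl , X≻r′ , r′≻Y

insertDesc-≻ : Linked _≥_ L → z < y → (insertDesc y L ++ Z) ≻ (L ++ z ∷ Z′)
insertDesc-≻ {[]}    _  z<y = here z<y
insertDesc-≻ {w ∷ L} {y = y} {Z} {Z′ = Z′} L↓ z<y with y ≥? w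
... | no _ = there (insertDesc-≻ (Linked.tail L↓) z<y)
... | yes w≤y with m≤n⇒m<n∨m≡n w≤y
...   | inj₁ w<y  = here w<y
...   | inj₂ refl = there (subst (λ V → (V ++ Z) ≻ (L ++ _ ∷ Z′)) (insertDesc-head L↓)
                                 (insertDesc-≻ (Linked.tail L↓) z<y))

¬replicate-1≻ : ∀ n {t} → All (0 <_) t → sum t ≡ n → ¬ (replicate n 1 ≻ t)
¬replicate-1≻ (suc n) {w ∷ t} (0<w ∷ _)  _     (here 1>w) = <⇒≱ 1>w 0<w
¬replicate-1≻ (suc n) {w ∷ t} (_ ∷ 0<t) sum≡ (there 1s≻t) =
  ¬replicate-1≻ n 0<t (suc-injective sum≡) 1s≻t

-- Moving a unit to a larger part

filter-filter-⊆ : ∀ {ℓ₁ ℓ₂} {P : Pred ℕ ℓ₁} {Q : Pred ℕ ℓ₂} (P? : Decidable P) (Q? : Decidable Q) →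
                  (∀ {n} → P n → Q n) → ∀ L → filter P? (filter Q? L) ≡ filter P? L
filter-filter-⊆ P? Q? P⊆Q []      = refl
filter-filter-⊆ P? Q? P⊆Q (y ∷ L) with Q? y
... | no ¬Qy = trans (filter-filter-⊆ P? Q? P⊆Q L) (sym (filter-reject P? (λ Py → ¬Qy (P⊆Q Py))))
... | yes _ with P? y
...   | yes _ = cong (y ∷_) (filter-filter-⊆ P? Q? P⊆Q L)
...   | no _  = filter-filter-⊆ P? Q? P⊆Q L

filter-++-reject-∷-++ : ∀ {ℓ} {P : Pred ℕ ℓ} (P? : Decidable P) Lp Lm Ls → ¬ P a →
  filter P? (Lp ++ a ∷ Lm ++ b ∷ Ls) ≡ filter P? (Lp ++ Lm) ++ filter P? (b ∷ Ls)
filter-++-reject-∷-++ {a} {b} P? Lp Lm Ls ¬Pa = begin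
  filter P? (Lp ++ a ∷ Lm ++ b ∷ Ls)                    ≡⟨ filter-++ P? Lp _ ⟩
  filter P? Lp ++ filter P? (a ∷ Lm ++ b ∷ Ls)         ≡⟨ cong (filter P? Lp ++_) (filter-reject P? ¬Pa) ⟩
  filter P? Lp ++ filter P? (Lm ++ b ∷ Ls)             ≡⟨ cong (filter P? Lp ++_) (filter-++ P? Lm _) ⟩
  filter P? Lp ++ (filter P? Lm ++ filter P? (b ∷ Ls)) ≡⟨ ++-assoc (filter P? Lp) _ _ ⟨
  (filter P? Lp ++ filter P? Lm) ++ filter P? (b ∷ Ls) ≡⟨ cong (_++ filter P? (b ∷ Ls)) (filter-++ P? Lp Lm) ⟨
  filter P? (Lp ++ Lm) ++ filter P? (b ∷ Ls)           ∎
  where open ≡-Reasoning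

sortDesc-bump-≻ : ∀ U A C Z → filter (x <?_) U ≡ A ++ suc x ∷ C → z ≤ x →
                  sortDesc U ≻ (sortDesc (A ++ C) ++ z ∷ Z)
sortDesc-bump-≻ {x} U A C Z above≡ z≤x =
  subst (_≻ (sortDesc (A ++ C) ++ _ ∷ Z)) (sym sortDesc-U)
        (insertDesc-≻ (sortDesc-Linked (A ++ C)) (s≤s z≤x))
  where
  below = sortDesc (filter (_≤? x) U)
  sortDesc-U : sortDesc U ≡ insertDesc (suc x) (sortDesc (A ++ C)) ++ below
  sortDesc-U = begin
    sortDesc U                                 ≡⟨ sortDesc-threshold x U ⟩
    sortDesc (filter (x <?_) U) ++ below        ≡⟨ cong (λ V → sortDesc V ++ below) above≡ ⟩
    sortDesc (A ++ suc x ∷ C) ++ below          ≡⟨ cong (_++ below) (sortDesc-++-∷ A (suc x) C) ⟩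
    insertDesc (suc x) (sortDesc (A ++ C)) ++ below ∎
    where open ≡-Reasoning

sortDesc-split-below : ∀ B D → y ≤ x →
  ∃₂ λ z Z → z ≤ x × sortDesc (B ++ y ∷ D) ≡ sortDesc (filter (x <?_) (B ++ y ∷ D)) ++ z ∷ Z
sortDesc-split-below {y} {x} B D y≤x with insertDesc-∷ y (sortDesc (filter (_≤? x) B ++ filter (_≤? x) D))
... | z , Z , insert≡ = z , Z , z≤x ,
  trans (sortDesc-threshold x (B ++ y ∷ D)) (cong (sortDesc (filter (x <?_) (B ++ y ∷ D)) ++_) below≡)
  where
  open ≡-Reasoning
  below≡ : sortDesc (filter (_≤? x) (B ++ y ∷ D)) ≡ z ∷ Z
  below≡ = begin
    sortDesc (filter (_≤? x) (B ++ y ∷ D))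
      ≡⟨ cong sortDesc (trans (filter-++ (_≤? x) B _) (cong (filter (_≤? x) B ++_) (filter-accept (_≤? x) y≤x))) ⟩
    sortDesc (filter (_≤? x) B ++ y ∷ filter (_≤? x) D)
      ≡⟨ sortDesc-++-∷ (filter (_≤? x) B) y _ ⟩
    insertDesc y (sortDesc (filter (_≤? x) B ++ filter (_≤? x) D))
      ≡⟨ insert≡ ⟩
    z ∷ Z ∎
  z≤x : z ≤ x
  z≤x = All.head (subst (All (_≤ x)) below≡ (sortDesc-All (all-filter (_≤? x) (B ++ y ∷ D))))

p-transfer-≻-below : ∀ Lp Lm Ls Z → a ≤ x → z ≤ x →
  p (Lp ++ (a ∸ 1) ∷ Lm ++ suc x ∷ Ls) ≻ (sortDesc (filter (x <?_) (Lp ++ a ∷ Lm ++ x ∷ Ls)) ++ z ∷ Z)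
p-transfer-≻-below {a} {x} Lp Lm Ls Z a≤x z≤x =
  subst (λ V → p new ≻ (sortDesc V ++ _ ∷ Z)) (sym above-old)
        (sortDesc-bump-≻ (filter (1 ≤?_) new) front back Z above-new z≤x)
  where
  new = Lp ++ (a ∸ 1) ∷ Lm ++ suc x ∷ Ls
  front = filter (x <?_) (Lp ++ Lm)
  back = filter (x <?_) Ls
  above-new : filter (x <?_) (filter (1 ≤?_) new) ≡ front ++ suc x ∷ back
  above-new = begin
    filter (x <?_) (filter (1 ≤?_) new)
      ≡⟨ filter-filter-⊆ (x <?_) (1 ≤?_) (≤-trans (s≤s z≤n)) new ⟩
    filter (x <?_) new
      ≡⟨ filter-++-reject-∷-++ (x <?_) Lp Lm Ls (≤⇒≯ (≤-trans (m∸n≤m a 1) a≤x)) ⟩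
    front ++ filter (x <?_) (suc x ∷ Ls)
      ≡⟨ cong (front ++_) (filter-accept (x <?_) ≤-refl) ⟩
    front ++ suc x ∷ back ∎
    where open ≡-Reasoning
  above-old : filter (x <?_) (Lp ++ a ∷ Lm ++ x ∷ Ls) ≡ front ++ back
  above-old = trans (filter-++-reject-∷-++ (x <?_) Lp Lm Ls (≤⇒≯ a≤x))
                    (cong (front ++_) (filter-reject (x <?_) (<-irrefl refl)))

p-transfer-≻ : ∀ Lp Lm Ls → a ≤ x → All (0 <_) (Lp ++ a ∷ Lm ++ x ∷ Ls) →
  p (Lp ++ (a ∸ 1) ∷ Lm ++ suc x ∷ Ls) ≻ p (Lp ++ a ∷ Lm ++ x ∷ Ls)
p-transfer-≻ {a} {x} Lp Lm Ls a≤x pos with sortDesc-split-below {x = x} Lp (Lm ++ x ∷ Ls) a≤x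
... | z , Z , z≤x , split =
  subst (p (Lp ++ (a ∸ 1) ∷ Lm ++ suc x ∷ Ls) ≻_)
        (sym (trans (cong sortDesc (filter-all (1 ≤?_) pos)) split))
        (p-transfer-≻-below Lp Lm Ls Z a≤x z≤x)

p-transfer-≻-above : ∀ {t} Lp Lm Ls R T W → Lp ++ a ∷ Lm ++ x ∷ Ls ≡ R ++ t ∷ T →
  a ≤ x → All (_≤ x) R → t ≤ x →
  p (Lp ++ (a ∸ 1) ∷ Lm ++ suc x ∷ Ls) ≻ (sortDesc (t ∷ T) ++ W)
p-transfer-≻-above {a} {x} {t} Lp Lm Ls R T W old≡ a≤x R≤x t≤x with sortDesc-split-below {x = x} [] T t≤x
... | z , Z , z≤x , split =
  subst (p (Lp ++ (a ∸ 1) ∷ Lm ++ suc x ∷ Ls) ≻_) (sym target≡) (p-transfer-≻-below Lp Lm Ls (Z ++ W) a≤x z≤x)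
  where
  open ≡-Reasoning
  above≡ : filter (x <?_) (Lp ++ a ∷ Lm ++ x ∷ Ls) ≡ filter (x <?_) (t ∷ T)
  above≡ = begin
    filter (x <?_) (Lp ++ a ∷ Lm ++ x ∷ Ls)   ≡⟨ cong (filter (x <?_)) old≡ ⟩
    filter (x <?_) (R ++ t ∷ T)               ≡⟨ filter-++ (x <?_) R _ ⟩
    filter (x <?_) R ++ filter (x <?_) (t ∷ T) ≡⟨ cong (_++ _) (filter-none (x <?_) (All.map ≤⇒≯ R≤x)) ⟩
    filter (x <?_) (t ∷ T)                     ∎
  target≡ : sortDesc (t ∷ T) ++ W ≡ sortDesc (filter (x <?_) (Lp ++ a ∷ Lm ++ x ∷ Ls)) ++ z ∷ Z ++ W
  target≡ = begin
    sortDesc (t ∷ T) ++ W                              ≡⟨ cong (_++ W) split ⟩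
    (sortDesc (filter (x <?_) (t ∷ T)) ++ z ∷ Z) ++ W   ≡⟨ ++-assoc (sortDesc (filter (x <?_) (t ∷ T))) _ W ⟩
    sortDesc (filter (x <?_) (t ∷ T)) ++ z ∷ Z ++ W     ≡⟨ cong (λ V → sortDesc V ++ z ∷ Z ++ W) above≡ ⟨
    sortDesc (filter (x <?_) (Lp ++ a ∷ Lm ++ x ∷ Ls)) ++ z ∷ Z ++ W ∎

-- Lexicographic successors

Linked-++⁻ˡ : ∀ {R : ℕ → ℕ → Set} L → Linked R (L ++ M) → Linked R L
Linked-++⁻ˡ []          _        = []
Linked-++⁻ˡ (x ∷ [])    _        = [-]
Linked-++⁻ˡ (x ∷ y ∷ L) (r ∷ L↓) = r ∷ Linked-++⁻ˡ (y ∷ L) L↓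

Linked-++-∷⁺ : ∀ {R : ℕ → ℕ → Set} L → Linked R L → All (λ w → R w y) L → Linked R (y ∷ M) →
               Linked R (L ++ y ∷ M)
Linked-++-∷⁺ []          _        _        y↓ = y↓
Linked-++-∷⁺ (x ∷ [])    _        (r ∷ []) y↓ = r ∷ y↓
Linked-++-∷⁺ (x ∷ w ∷ L) (r ∷ L↓) (_ ∷ rs) y↓ = r ∷ Linked-++-∷⁺ (w ∷ L) L↓ rs y↓

Linked-∷-replicate-1 : ∀ c → 1 ≤ y → Linked _≥_ (y ∷ replicate c 1)
Linked-∷-replicate-1 zero    _   = [-]
Linked-∷-replicate-1 (suc c) 1≤y = 1≤y ∷ Linked-∷-replicate-1 c ≤-refl

sum-replicate-1 : ∀ c → sum (replicate c 1) ≡ c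
sum-replicate-1 zero    = refl
sum-replicate-1 (suc c) = cong suc (sum-replicate-1 c)

nothing-between-last-two : ∀ b c {r} → All (0 <_) r → sum r ≡ sum (b ∷ suc c ∷ []) →
  ¬ ((suc b ∷ replicate c 1) ≻ r × r ≻ (b ∷ suc c ∷ []))
nothing-between-last-two b c _ _ (here w<1+b , here b<w) = <⇒≱ b<w (≤-pred w<1+b)
nothing-between-last-two b c {_ ∷ t} (_ ∷ 0<t) sum≡ (there 1s≻t , here _) =
  ¬replicate-1≻ c 0<t
    (trans (+-cancelˡ-≡ b _ _ (suc-injective (trans sum≡ (+-suc b (c + 0))))) (+-identityʳ c)) 1s≻t
nothing-between-last-two b c {_ ∷ w ∷ t} _ sum≡ (_ , there (here 1+c<w)) =
  <⇒≱ 1+c<w (subst (w ≤_) (trans (+-cancelˡ-≡ b _ _ sum≡) (+-identityʳ (suc c))) (m≤m+n w (sum t)))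
nothing-between-last-two b c {_ ∷ _ ∷ w ∷ t} (_ ∷ _ ∷ 0<w ∷ _) sum≡ (_ , there (there nonempty)) =
  <⇒≢ 0<w (sym (m+n≡0⇒m≡0 w (+-cancelˡ-≡ (suc c) _ _ (+-cancelˡ-≡ b _ _ sum≡))))

IsNext-++-last-two : ∀ P → IsPartition k (P ++ b ∷ suc c ∷ []) → All (b <_) P →
  IsNext k (P ++ b ∷ suc c ∷ []) (P ++ suc b ∷ replicate c 1)
IsNext-++-last-two {k} {b} {c} P λ-part@(λ↓ , λ-pos , λ-sum) b<P =
  λ-part , μ-part , ≻-++ˡ P (here ≤-refl) , nothing-between
  where
  last-two-sum : suc b + sum (replicate c 1) ≡ sum (b ∷ suc c ∷ [])
  last-two-sum = begin
    suc b + sum (replicate c 1) ≡⟨ cong (suc b +_) (sum-replicate-1 c) ⟩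
    suc b + c                   ≡⟨ +-suc b c ⟨
    b + suc c                   ≡⟨ cong (b +_) (+-identityʳ (suc c)) ⟨
    b + (suc c + 0)             ∎
    where open ≡-Reasoning
  μ-part : IsPartition k (P ++ suc b ∷ replicate c 1)
  μ-part = Linked-++-∷⁺ P (Linked-++⁻ˡ P λ↓) b<P (Linked-∷-replicate-1 c (s≤s z≤n)) ,
           ++⁺ (++⁻ˡ P λ-pos) (s≤s z≤n ∷ replicate⁺ c (s≤s z≤n)) ,
           trans (sum-++ P _) (trans (cong (sum P +_) last-two-sum) (trans (sym (sum-++ P _)) λ-sum))
  nothing-between : ∀ r → IsPartition k r → ¬ ((P ++ suc b ∷ replicate c 1) ≻ r × r ≻ (P ++ b ∷ suc c ∷ []))
  nothing-between r (_ , r-pos , r-sum) (μ≻r , r≻λ) with between-++ˡ P μ≻r r≻λ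
  ... | r′ , refl , μ′≻r′ , r′≻λ′ =
    nothing-between-last-two b c (++⁻ʳ P r-pos)
      (+-cancelˡ-≡ (sum P) _ _ (trans (sym (sum-++ P r′)) (trans r-sum (trans (sym λ-sum) (sum-++ P _)))))
      (μ′≻r′ , r′≻λ′)

p-IsNext-two-smallest : ∀ a b T → 0 < a → a ≤ b → All (b <_) T →
  IsNext (sum (a ∷ b ∷ T)) (p (a ∷ b ∷ T)) (sortDesc T ++ suc b ∷ replicate (a ∸ 1) 1)
p-IsNext-two-smallest (suc c) b T _ a≤b b<T =
  subst (λ V → IsNext total V (sortDesc T ++ suc b ∷ replicate c 1)) (sym p≡)
        (IsNext-++-last-two (sortDesc T) (subst (IsPartition total) p≡ (p-IsPartition (suc c ∷ b ∷ T)))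
                            (sortDesc-All b<T))
  where
  total = sum (suc c ∷ b ∷ T)
  b∷T⁺ : All (0 <_) (b ∷ T)
  b∷T⁺ = ≤-trans (s≤s z≤n) a≤b ∷ All.map (≤-trans (s≤s z≤n)) b<T
  p≡ : p (suc c ∷ b ∷ T) ≡ sortDesc T ++ b ∷ suc c ∷ []
  p≡ = trans (cong (λ V → sortDesc (suc c ∷ V)) (filter-all (1 ≤?_) b∷T⁺))
             (sortDesc-∷-∷-min a≤b (All.map <⇒≤ b<T))

p-IsNext-split-smallest : ∀ a T → 2 ≤ a → All (a ≤_) T →
  IsNext (sum (a ∷ T)) (p (1 ∷ (a ∸ 1) ∷ T)) (p (a ∷ T))
p-IsNext-split-smallest (suc (suc b)) T (s≤s (s≤s z≤n)) a≤T =
  subst₂ (IsNext total) (sym p₁≡) (sym p₀≡)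
         (IsNext-++-last-two (sortDesc T) (subst (IsPartition total) p₁≡ (p-IsPartition (1 ∷ suc b ∷ T)))
                             (sortDesc-All a≤T))
  where
  total = sum (suc (suc b) ∷ T)
  T⁺ : filter (1 ≤?_) T ≡ T
  T⁺ = filter-all (1 ≤?_) (All.map (≤-trans (s≤s z≤n)) a≤T)
  p₀≡ : p (suc (suc b) ∷ T) ≡ sortDesc T ++ suc (suc b) ∷ []
  p₀≡ = trans (cong (λ V → sortDesc (suc (suc b) ∷ V)) T⁺) (sortDesc-∷-min a≤T)
  p₁≡ : p (1 ∷ suc b ∷ T) ≡ sortDesc T ++ suc b ∷ 1 ∷ []
  p₁≡ = trans (cong (λ V → sortDesc (1 ∷ suc b ∷ V)) T⁺)
              (sortDesc-∷-∷-min (s≤s z≤n) (All.map (≤-trans (n≤1+n (suc b))) a≤T))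

toList-updateAt : ∀ {n} (f : Fin n → ℕ) j → ∃₂ λ Lp Ls →
  toList f ≡ Lp ++ f j ∷ Ls × (∀ g → toList (updateAt f j g) ≡ Lp ++ g (f j) ∷ Ls)
toList-updateAt f fz     = [] , toList (λ k → f (fs k)) , refl , λ _ → refl
toList-updateAt f (fs j) with toList-updateAt (λ k → f (fs k)) j
... | Lp , Ls , f≡ , update≡ = f fz ∷ Lp , Ls , cong (f fz ∷_) f≡ , λ g → cong (f fz ∷_) (update≡ g)

toList-updateAt₂ : ∀ {n} (f : Fin n → ℕ) i j → toℕ i < toℕ j → ∀ g h → ∃₂ λ Lp Lm → ∃ λ Ls →
  toList f ≡ Lp ++ f i ∷ Lm ++ f j ∷ Ls ×
  toList (updateAt (updateAt f j g) i h) ≡ Lp ++ h (f i) ∷ Lm ++ g (f j) ∷ Ls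
toList-updateAt₂ f fz (fs j) _ g h with toList-updateAt (λ k → f (fs k)) j
... | Lm , Ls , f≡ , update≡ = [] , Lm , Ls , cong (f fz ∷_) f≡ , cong (h (f fz) ∷_) (update≡ g)
toList-updateAt₂ f (fs i) (fs j) (s≤s i<j) g h with toList-updateAt₂ (λ k → f (fs k)) i j i<j g h
... | Lp , Lm , Ls , f≡ , update≡ = f fz ∷ Lp , Lm , Ls , cong (f fz ∷_) f≡ , cong (f fz ∷_) update≡

transfer-≻ : ∀ {ν} (v : Fin ν → ℕ) → (∀ a b → toℕ a ≤ toℕ b → v a ≤ v b) → (∀ a → v a > 0)
  → (j i : Fin ν) → toℕ i < toℕ j
  → p (toList (updateAt (updateAt v j suc) i (_∸ 1))) ≻ p (toList v)
transfer-≻ v mono pos j i i<j with toList-updateAt₂ v i j i<j suc (_∸ 1)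
... | Lp , Lm , Ls , old≡ , new≡ =
  subst₂ _≻_ (sym (cong p new≡)) (sym (cong p old≡))
         (p-transfer-≻ Lp Lm Ls (mono i j (<⇒≤ i<j)) (subst (All (0 <_)) old≡ (tabulate⁺ pos)))

transfer-≻-next : ∀ {ν} (v : Fin ν → ℕ) → (∀ a b → toℕ a ≤ toℕ b → v a ≤ v b) → (∀ a → v a > 0)
  → (a₃ a₂ : Fin ν) → toℕ a₃ ≡ 2 → toℕ a₂ ≡ 1 → v a₃ > v a₂
  → (j i : Fin ν) → 2 ≤ toℕ j → toℕ i < 2
  → Σ (List ℕ) λ q → IsNext (sum (toList v)) (p (toList v)) q
      × p (toList (updateAt (updateAt v j suc) i (_∸ 1))) ≻ q
transfer-≻-next v _ _ _ _ _ _ _ fz _ () _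
transfer-≻-next v _ _ _ _ _ _ _ (fs fz) _ (s≤s ()) _
transfer-≻-next {suc (suc zero)} v _ _ _ _ _ _ _ (fs (fs ())) _ _ _
transfer-≻-next {suc (suc (suc ν))} v mono pos a₃ a₂ a₃≡2 a₂≡1 v₂<v₃ j@(fs (fs _)) i 2≤j i<2
  with toList-updateAt₂ v i j (<-≤-trans i<2 2≤j) suc (_∸ 1)
... | Lp , Lm , Ls , old≡ , new≡ =
  _ , p-IsNext-two-smallest (v fz) (v (fs fz)) T (pos fz) (mono fz (fs fz) z≤n) (tabulate⁺ v₁<T) ,
  subst (_≻ _) (sym (cong p new≡))
        (p-transfer-≻-above Lp Lm Ls (v fz ∷ v (fs fz) ∷ []) _ _ (sym old≡)
           (mono i j (<⇒≤ (<-≤-trans i<2 2≤j)))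
           (mono fz j z≤n ∷ mono (fs fz) j (s≤s z≤n) ∷ [])
           (mono (fs (fs fz)) j 2≤j))
  where
  T = toList (λ k → v (fs (fs k)))
  v₁<T : ∀ k → v (fs fz) < v (fs (fs k))
  v₁<T k = ≤-<-trans (mono (fs fz) a₂ (≤-reflexive (sym a₂≡1)))
             (<-≤-trans v₂<v₃ (mono a₃ (fs (fs k)) (subst (_≤ 2 + toℕ k) (sym a₃≡2) (s≤s (s≤s z≤n)))))

split-smallest-IsNext : ∀ {ν} (v : Fin ν → ℕ) → (∀ a b → toℕ a ≤ toℕ b → v a ≤ v b)
  → (a₁ : Fin ν) → toℕ a₁ ≡ 0 → 2 ≤ v a₁
  → IsNext (sum (toList v)) (p (1 ∷ toList (updateAt v a₁ (_∸ 1)))) (p (toList v))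
split-smallest-IsNext v mono fz _ 2≤v₁ =
  p-IsNext-split-smallest (v fz) _ 2≤v₁ (tabulate⁺ (λ k → mono fz (fs k) z≤n))

split-one : ∀ {ν} (v : Fin ν → ℕ) (a₁ : Fin ν) → toℕ a₁ ≡ 0 → v a₁ ≡ 1
  → p (1 ∷ toList (updateAt v a₁ (_∸ 1))) ≡ p (toList v)
split-one v fz _ v₁≡1 rewrite v₁≡1 = refl

lemma33 : (ν : ℕ) → 2 ≤ ν → (v : Fin ν → ℕ)
    → (∀ a b → toℕ a ≤ toℕ b → v a ≤ v b) → (∀ a → v a > 0)
    → ((j i : Fin ν) → toℕ i < toℕ j
        → p (toList (updateAt (updateAt v j suc) i (_∸ 1))) ≻ p (toList v))
    × ((a₃ a₂ : Fin ν) → toℕ a₃ ≡ 2 → toℕ a₂ ≡ 1 → v a₃ > v a₂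
        → (j i : Fin ν) → 2 ≤ toℕ j → toℕ i < 2
        → Σ (List ℕ) λ q → IsNext (sum (toList v)) (p (toList v)) q
            × p (toList (updateAt (updateAt v j suc) i (_∸ 1))) ≻ q)
    × ((a₁ : Fin ν) → toℕ a₁ ≡ 0 → 2 ≤ v a₁
        → IsNext (sum (toList v)) (p (1 ∷ toList (updateAt v a₁ (_∸ 1)))) (p (toList v)))
    × ((a₁ : Fin ν) → toℕ a₁ ≡ 0 → v a₁ ≡ 1
        → p (1 ∷ toList (updateAt v a₁ (_∸ 1))) ≡ p (toList v))
lemma33 ν _ v mono pos =
  transfer-≻ v mono pos , transfer-≻-next v mono pos , split-smallest-IsNext v mono , split-one v
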